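{- Let $B$ be a spanning tree of a connected finite graph $G$ and let $\overrightarrow{C}$ be a directed cycle of $G$. Let $\overrightarrow{e_1},\dots,\overrightarrow{e_m}$ be the arcs of $\overrightarrow{C}$ on edges not in $B$, listed in the order in which they appear along $\overrightarrow{C}$ (starting anywhere), so that $\overrightarrow{C}=\sum_{i=1}^m\overrightarrow{C}(B,\overrightarrow{e_i})$. Then this sum can be completely parenthesized so that every intermediate sum of two terms formed during the summation is a directed cycle.
   Context: $G$ has edge set $E$, multiple edges allowed, with a fixed reference orientation. A directed cycle is a simple cycle traversed in one cyclic direction, identified with its vector in $\{0,\pm1\}^E$ ($+1$ on edges traversed along the reference orientation, $-1$ against, $0$ elsewhere); arcs are the two traversal directions of an edge. For an edge $e\notin B$ with arc $\overrightarrow{e}$, $\overrightarrow{C}(B,\overrightarrow{e})$ is the fundamental cycle of $e$ with respect to $B$ (the unique cycle in $B\cup\{e\}$) directed so that it traverses $e$ as $\overrightarrow{e}$. A complete parenthesization, e.g. $(\overrightarrow{C_1}+\overrightarrow{C_2})+(\overrightarrow{C_3}+(\overrightarrow{C_4}+\overrightarrow{C_5}))$, is required here to have $\overrightarrow{C_1}+\overrightarrow{C_2}$, $\overrightarrow{C_4}+\overrightarrow{C_5}$, $\overrightarrow{C_3}+(\overrightarrow{C_4}+\overrightarrow{C_5})$ all directed cycles. -}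

module Defs where

open import Data.Nat using (ℕ)
open import Data.Fin using (Fin; _≟_)
open import Data.Bool using (Bool; true; false; not)
open import Data.Integer using (ℤ; 0ℤ; 1ℤ; -1ℤ; _+_)
open import Data.List using (List; []; _∷_; _++_; map; filterᵇ)
open import Data.List.Relation.Unary.All using (All)
open import Data.List.Relation.Unary.Unique.Propositional using (Unique)
open import Data.List.Membership.Propositional using (_∈_)
open import Data.Product using (Σ; ∃; _×_; _,_; proj₁)
open import Data.Sum using (_⊎_)
open import Data.Unit using (⊤)
open import Data.Empty using (⊥)
open import Relation.Nullary using (¬_; yes; no)
open import Relation.Binary.PropositionalEquality using (_≡_; _≗_)
open import Function using (_∘_)

-- A finite graph with vertex set Fin nV and edge set Fin nE; multiple edges
-- (and loops) allowed. Each edge e carries a reference orientation src e → tgt e.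
record Graph : Set where
  field
    nV  : ℕ
    nE  : ℕ
    src : Fin nE → Fin nV
    tgt : Fin nE → Fin nV

module _ (G : Graph) where
  open Graph G

  Edge : Set
  Edge = Fin nE

  Vertex : Set
  Vertex = Fin nV

  -- An arc: an edge together with a traversal direction
  -- (true = along the reference orientation, false = against it).
  Arc : Set
  Arc = Edge × Bool

  edgeOf : Arc → Edge
  edgeOf = proj₁

  tailOf : Arc → Vertex
  tailOf (e , true)  = src e
  tailOf (e , false) = tgt e

  headOf : Arc → Vertex
  headOf (e , true)  = tgt e
  headOf (e , false) = src e

  sign : Bool → ℤ
  sign true  = 1ℤ
  sign false = -1ℤ

  EVec : Set
  EVec = Edge → ℤ

  _+ᵥ_ : EVec → EVec → EVec
  (u +ᵥ v) e = u e + v e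

  data Walk : Vertex → List Arc → Vertex → Set where
    nil  : ∀ {v} → Walk v [] v
    cons : ∀ {u v} a {as} → tailOf a ≡ u → Walk (headOf a) as v → Walk u (a ∷ as) v

  -- A directed (simple) cycle, as a cyclic sequence of arcs starting at some arc:
  -- nonempty closed walk, with pairwise distinct vertices and distinct edges.
  IsCycleWalk : List Arc → Set
  IsCycleWalk [] = ⊥
  IsCycleWalk w@(_ ∷ _) =
    (∃ λ v → Walk v w v) × Unique (map tailOf w) × Unique (map edgeOf w)

  vecOf : List Arc → EVec
  vecOf [] e = 0ℤ
  vecOf ((f , d) ∷ as) e with f ≟ e
  ... | yes _ = sign d + vecOf as e
  ... | no  _ = vecOf as e

  IsDirectedCycle : EVec → Set
  IsDirectedCycle v = ∃ λ w → IsCycleWalk w × v ≗ vecOf w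

  Connected : Set
  Connected = ∀ u v → ∃ λ w → Walk u w v

  _∈B_ : Edge → (Edge → Bool) → Set
  e ∈B B = B e ≡ true

  IsSpanningTree : (Edge → Bool) → Set
  IsSpanningTree B =
    (∀ u v → ∃ λ w → Walk u w v × All (λ a → edgeOf a ∈B B) w)
    × (∀ w → IsCycleWalk w → ¬ All (λ a → edgeOf a ∈B B) w)

  IsFundamentalCycle : (Edge → Bool) → Arc → EVec → Set
  IsFundamentalCycle B a c =
    ∃ λ w → IsCycleWalk w
          × All (λ b → (edgeOf b ∈B B) ⊎ (edgeOf b ≡ edgeOf a)) w
          × a ∈ w
          × c ≗ vecOf w

  nonTreeArcs : (Edge → Bool) → List Arc → List Arc
  nonTreeArcs B = filterᵇ (not ∘ B ∘ edgeOf)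

  -- Complete parenthesizations of a sum whose list of terms is cs.
  data Paren : List EVec → Set where
    leaf : ∀ c → Paren (c ∷ [])
    node : ∀ {xs ys} → Paren xs → Paren ys → Paren (xs ++ ys)

  value : ∀ {cs} → Paren cs → EVec
  value (leaf c)   = c
  value (node l r) = value l +ᵥ value r

  -- Every sum of two terms formed in a (non-root) subterm is a directed cycle.
  InnerOK : ∀ {cs} → Paren cs → Set
  InnerOK (leaf _)   = ⊤
  InnerOK (node l r) = IsDirectedCycle (value l +ᵥ value r) × InnerOK l × InnerOK r

  -- Every intermediate sum of two terms formed during the summation is a
  -- directed cycle (the final sum, being C itself, is not required separately).
  GoodParen : ∀ {cs} → Paren cs → Set
  GoodParen (leaf _)   = ⊤
  GoodParen (node l r) = InnerOK l × InnerOK r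

-- A closed walk using only tree arcs has zero vector: a repeated vertex splits it into two
-- shorter closed walks, an arc followed by its reversal cancels, and otherwise it would be a
-- cycle inside the tree. Hence a directed cycle with a single non-tree arc a is C(B, a).
--
-- Let the cycle have non-tree arcs a₁, …, aₘ with m ≥ 2, and rotate it to L M where L ends
-- with a₁ and is otherwise in B, and M ends with aₘ. The tree path from the tail of a₁ to the
-- tail of aₘ contains a subpath Q from a vertex y of L to a vertex x of M whose inner vertices
-- avoid the cycle. Q shares no edge with the cycle either, since a tree arc of the cycle has
-- both ends in L or both in M. Cutting the cycle at y and x and closing the two halves with Q
-- gives directed cycles D₁, D₂ with D₁ + D₂ equal to the cycle, whose non-tree arcs are
-- a₁, …, aₖ and aₖ₊₁, …, aₘ in order; recursing on D₁ and D₂ parenthesizes the sum.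

module Submission where

open import Defs
open import Data.Bool using (Bool; true; false; not; T; T?)
open import Data.Unit using (tt)
open import Data.Empty using (⊥-elim)
open import Data.List using (List; []; _∷_; _++_; _∷ʳ_; [_]; map; filter; length)
open import Data.List.Properties
  using (++-assoc; ++-identityʳ; ++-conicalʳ; map-++; ∷-injectiveˡ; ∷-injectiveʳ; length-++-≤ʳ;
         filter-++; filter-accept; filter-reject; filter-none)
open import Data.List.Membership.Propositional using (_∈_; find)
open import Data.List.Membership.Propositional.Properties
  using (∈-++⁺ˡ; ∈-++⁺ʳ; ∈-++⁻; ∈-∃++; ∈-map⁺; ∈-map⁻)
open import Data.List.Relation.Binary.Disjoint.Propositional using (Disjoint)
open import Data.List.Relation.Binary.Permutation.Propositional
  using (_↭_; ↭⇒↭ₛ; ↭-refl; ↭-sym; ↭-trans; prep)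
open import Data.List.Relation.Binary.Permutation.Propositional.Properties using (++-comm; map⁺; ∈-resp-↭)
import Data.List.Relation.Binary.Permutation.Setoid.Properties as ↭ₛ
open import Data.List.Relation.Binary.Subset.Propositional using (_⊆_)
import Data.List.Relation.Binary.Subset.Propositional.Properties as Subsetₚ
open import Data.List.Relation.Binary.Pointwise using (Pointwise; []; _∷_)
open import Data.List.Relation.Unary.All as All using (All; []; _∷_)
import Data.List.Relation.Unary.All.Properties as Allₚ
open import Data.List.Relation.Unary.Any using (here; there; any?)
open import Data.List.Relation.Unary.Unique.Propositional using (Unique; []; _∷_)
import Data.List.Relation.Unary.Unique.Propositional.Properties as Uniqueₚ
open import Data.Nat using (_<_; z≤n; s≤s)
open import Data.Nat.Induction using (<-wellFounded)
open import Data.Nat.Properties using (m<n⇒m<1+n)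
open import Data.Product using (Σ; ∃; ∃₂; _×_; _,_; proj₁; proj₂)
open import Data.Sum using (_⊎_; inj₁; inj₂)
open import Function using (_∘_; _on_)
open import Induction.WellFounded using (WellFounded; Acc; acc)
open import Relation.Binary using (Rel; DecidableEquality)
open import Relation.Binary.Construct.On as On using ()
open import Relation.Binary.PropositionalEquality
  using (_≡_; _≢_; refl; sym; trans; cong; cong₂; subst; subst₂; setoid; ≢-sym; module ≡-Reasoning)
open import Data.Integer using (0ℤ; _+_; -_)
import Data.Integer.Properties as ℤₚ
open import Data.Integer.Tactic.RingSolver using (solve-∀)
open import Data.Fin using (_≟_)
open import Relation.Nullary using (¬_; yes; no)
open import Relation.Unary using (Decidable; ∁)

module _ {A : Set} where

  Unique-++⁻ : ∀ (xs : List A) {ys} → Unique (xs ++ ys) → Unique xs × Unique ys × Disjoint xs ys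
  Unique-++⁻ []       u          = [] , u , λ ()
  Unique-++⁻ (x ∷ xs) (x∉ ∷ u) with Unique-++⁻ xs u
  ... | uxs , uys , xs#ys = Allₚ.++⁻ˡ xs x∉ ∷ uxs , uys , λ where
    (here refl  , v∈ys) → All.lookup x∉ (∈-++⁺ʳ xs v∈ys) refl
    (there v∈xs , v∈ys) → xs#ys (v∈xs , v∈ys)

  Unique-resp-↭ : ∀ {xs ys : List A} → xs ↭ ys → Unique xs → Unique ys
  Unique-resp-↭ p = ↭ₛ.Unique-resp-↭ (setoid A) (↭⇒↭ₛ p)

  length-<-++∷ : ∀ (xs : List A) {y ys} → length xs < length (xs ++ y ∷ ys)
  length-<-++∷ []       = s≤s z≤n
  length-<-++∷ (x ∷ xs) = s≤s (length-<-++∷ xs)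

  length-++-< : ∀ (α : List A) {x β γ} → length (α ++ γ) < length (α ++ x ∷ β ++ γ)
  length-++-< []      {β = β} {γ} = s≤s (length-++-≤ʳ γ {β})
  length-++-< (_ ∷ α)             = s≤s (length-++-< α)

  length-∷-< : ∀ (α : List A) {x β y γ} → length (x ∷ β) < length (α ++ x ∷ β ++ y ∷ γ)
  length-∷-< []      {β = β} = s≤s (length-<-++∷ β)
  length-∷-< (_ ∷ α)         = m<n⇒m<1+n (length-∷-< α)

  ∷ʳ≡++∷⇒prefix : ∀ (xs ys : List A) {z y ys′} → xs ∷ʳ z ≡ ys ++ y ∷ ys′ → ∃ λ zs → xs ≡ ys ++ zs
  ∷ʳ≡++∷⇒prefix xs       []       _  = xs , refl
  ∷ʳ≡++∷⇒prefix []       (_ ∷ ys) eq with () ← ++-conicalʳ ys _ (sym (∷-injectiveʳ eq))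
  ∷ʳ≡++∷⇒prefix (x ∷ xs) (_ ∷ ys) eq with refl ← ∷-injectiveˡ eq
    with zs , refl ← ∷ʳ≡++∷⇒prefix xs ys (∷-injectiveʳ eq) = zs , refl

  ∷≡∷ʳ : ∀ (x : A) xs → ∃₂ λ ys y → x ∷ xs ≡ ys ∷ʳ y
  ∷≡∷ʳ x []        = [] , x , refl
  ∷≡∷ʳ x (x′ ∷ xs) with ys , y , eq ← ∷≡∷ʳ x′ xs = x ∷ ys , y , cong (x ∷_) eq

  Shorter : Rel (List A) _
  Shorter = _<_ on length

  shorter-wellFounded : WellFounded Shorter
  shorter-wellFounded = On.wellFounded length <-wellFounded

  ++-shorterˡ : ∀ xs {ys} → ys ≢ [] → Shorter xs (xs ++ ys)
  ++-shorterˡ xs {[]}    ys≢[] = ⊥-elim (ys≢[] refl)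
  ++-shorterˡ xs {_ ∷ _} _     = length-<-++∷ xs

  ++-shorterʳ : ∀ {xs} ys → xs ≢ [] → Shorter ys (xs ++ ys)
  ++-shorterʳ {[]}     ys xs≢[] = ⊥-elim (xs≢[] refl)
  ++-shorterʳ {_ ∷ xs} ys _     = s≤s (length-++-≤ʳ ys {xs})

module _ {A B : Set} (f : A → B) where

  data Collision : List A → Set where
    collision : ∀ α a β b γ → f a ≡ f b → Collision (α ++ a ∷ β ++ b ∷ γ)

  Collision⇒¬Unique : ∀ {xs} → Collision xs → ¬ Unique (map f xs)
  Collision⇒¬Unique (collision [] a β b γ fa≡fb) (fa∉ ∷ _) =
    All.lookup fa∉ (∈-map⁺ f (∈-++⁺ʳ β (here refl))) fa≡fb
  Collision⇒¬Unique (collision (x ∷ α) a β b γ fa≡fb) (_ ∷ u) =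
    Collision⇒¬Unique (collision α a β b γ fa≡fb) u

  unique⊎collision : DecidableEquality B → ∀ xs → Unique (map f xs) ⊎ Collision xs
  unique⊎collision _≟_ []       = inj₁ []
  unique⊎collision _≟_ (x ∷ xs) with any? (λ y → f x ≟ f y) xs
  ... | yes hit with y , y∈xs , fx≡fy ← find hit with β , γ , refl ← ∈-∃++ y∈xs =
    inj₂ (collision [] x β y γ fx≡fy)
  ... | no miss with unique⊎collision _≟_ xs
  ...   | inj₁ u = inj₁ (Allₚ.map⁺ (Allₚ.¬Any⇒All¬ xs miss) ∷ u)
  ...   | inj₂ (collision α a β b γ fa≡fb) = inj₂ (collision (x ∷ α) a β b γ fa≡fb)

  Unique-map-middle : ∀ xs {x ys} → Unique (map f (xs ++ x ∷ ys)) → All (λ y → f y ≢ f x) (xs ++ ys)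
  Unique-map-middle []       (fx∉ ∷ _) = Allₚ.map⁻ (All.map ≢-sym fx∉)
  Unique-map-middle (y ∷ xs) (fy∉ ∷ u) =
    All.lookup fy∉ (∈-map⁺ f (∈-++⁺ʳ xs (here refl))) ∷ Unique-map-middle xs u

module _ {A : Set} {P : A → Set} where

  All-middle : ∀ α β {γ : List A} → All P (α ++ β ++ γ) → All P β
  All-middle α β = Allₚ.++⁻ˡ β ∘ Allₚ.++⁻ʳ α

  All-deleteMiddle : ∀ α β {γ : List A} → All P (α ++ β ++ γ) → All P (α ++ γ)
  All-deleteMiddle α β ps = Allₚ.++⁺ (Allₚ.++⁻ˡ α ps) (Allₚ.++⁻ʳ β (Allₚ.++⁻ʳ α ps))

module _ {A : Set} {P : A → Set} (P? : Decidable P) where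

  filter≡[]⇒All∁ : ∀ xs → filter P? xs ≡ [] → All (∁ P) xs
  filter≡[]⇒All∁ []       _  = []
  filter≡[]⇒All∁ (x ∷ xs) eq with P? x
  ... | no ¬px = ¬px ∷ filter≡[]⇒All∁ xs eq

  filter≡∷⁻ : ∀ xs {y ys} → filter P? xs ≡ y ∷ ys →
    ∃₂ λ pre post → xs ≡ pre ++ y ∷ post × All (∁ P) pre × P y × filter P? post ≡ ys
  filter≡∷⁻ (x ∷ xs) eq with P? x
  ... | yes px with refl ← eq = [] , xs , refl , [] , px , refl
  ... | no ¬px with pre , post , refl , ∁pre , py , eq′ ← filter≡∷⁻ xs eq =
    x ∷ pre , post , refl , ¬px ∷ ∁pre , py , eq′

  filter≡∷ʳ⁻ : ∀ xs {ys y} → filter P? xs ≡ ys ∷ʳ y →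
    ∃₂ λ pre post → xs ≡ pre ++ y ∷ post × filter P? pre ≡ ys × P y × All (∁ P) post
  filter≡∷ʳ⁻ [] {[]}    ()
  filter≡∷ʳ⁻ [] {_ ∷ _} ()
  filter≡∷ʳ⁻ (x ∷ xs) {ys} eq with P? x | ys
  ... | yes px | [] with refl ← ∷-injectiveˡ eq =
    [] , xs , refl , refl , px , filter≡[]⇒All∁ xs (∷-injectiveʳ eq)
  ... | yes px | _ ∷ ys′ with refl ← ∷-injectiveˡ eq
                         with pre , post , refl , eq′ , py , ∁post ← filter≡∷ʳ⁻ xs (∷-injectiveʳ eq) =
    x ∷ pre , post , refl , trans (filter-accept P? px) (cong (x ∷_) eq′) , py , ∁post
  ... | no ¬px | _ with pre , post , refl , eq′ , py , ∁post ← filter≡∷ʳ⁻ xs eq =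
    x ∷ pre , post , refl , trans (filter-reject P? ¬px) eq′ , py , ∁post

module _ {A B : Set} {R : A → B → Set} where

  Pointwise-++⁻ : ∀ xs {ys cs} → Pointwise R (xs ++ ys) cs →
    ∃₂ λ cs₁ cs₂ → cs ≡ cs₁ ++ cs₂ × Pointwise R xs cs₁ × Pointwise R ys cs₂
  Pointwise-++⁻ []       rs       = [] , _ , refl , [] , rs
  Pointwise-++⁻ (x ∷ xs) (r ∷ rs) with cs₁ , cs₂ , refl , rs₁ , rs₂ ← Pointwise-++⁻ xs rs =
    _ ∷ cs₁ , cs₂ , refl , r ∷ rs₁ , rs₂

  Pointwise-≢[] : ∀ {xs ys} → Pointwise R xs ys → xs ≢ [] → ys ≢ []
  Pointwise-≢[] []      xs≢[] _ = xs≢[] refl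
  Pointwise-≢[] (_ ∷ _) _     ()

-- Walks

module _ (G : Graph) where

  private
    variable
      u v m : Vertex G
      a : Arc G
      as xs ys : List (Arc G)

  tl hd : Arc G → Vertex G
  tl = tailOf G
  hd = headOf G

  ed : Arc G → Edge G
  ed = edgeOf G

  tails heads : List (Arc G) → List (Vertex G)
  tails = map tl
  heads = map hd

  edges : List (Arc G) → List (Edge G)
  edges = map ed

  walk-++⁻ : ∀ xs → Walk G u (xs ++ ys) v → ∃ λ m → Walk G u xs m × Walk G m ys v
  walk-++⁻ []       w               = _ , nil , w
  walk-++⁻ (x ∷ xs) (cons _ refl w) with m , w₁ , w₂ ← walk-++⁻ xs w = m , cons x refl w₁ , w₂

  _++ʷ_ : Walk G u xs m → Walk G m ys v → Walk G u (xs ++ ys) v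
  nil          ++ʷ w₂ = w₂
  cons a eq w₁ ++ʷ w₂ = cons a eq (w₁ ++ʷ w₂)

  walk-start : Walk G u (a ∷ as) v → tl a ≡ u
  walk-start (cons _ eq _) = eq

  tails-∷ʳ : Walk G u as v → tails as ∷ʳ v ≡ u ∷ heads as
  tails-∷ʳ nil             = refl
  tails-∷ʳ (cons a refl w) = cong (tl a ∷_) (tails-∷ʳ w)

  heads⊆tails-∷ʳ : Walk G u as v → heads as ⊆ tails as ∷ʳ v
  heads⊆tails-∷ʳ w z∈ = subst (_ ∈_) (sym (tails-∷ʳ w)) (there z∈)

  reverseArc : Arc G → Arc G
  reverseArc (e , d) = e , not d

  tl-reverseArc : ∀ a → tl (reverseArc a) ≡ hd a
  tl-reverseArc (_ , true)  = refl
  tl-reverseArc (_ , false) = refl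

  hd-reverseArc : ∀ a → hd (reverseArc a) ≡ tl a
  hd-reverseArc (_ , true)  = refl
  hd-reverseArc (_ , false) = refl

  reverseArcs : List (Arc G) → List (Arc G)
  reverseArcs []       = []
  reverseArcs (a ∷ as) = reverseArcs as ∷ʳ reverseArc a

  walk-reverse : Walk G u as v → Walk G v (reverseArcs as) u
  walk-reverse nil               = nil
  walk-reverse (cons a refl w) =
    walk-reverse w ++ʷ cons (reverseArc a) (tl-reverseArc a)
                            (subst (λ z → Walk G z [] (tl a)) (sym (hd-reverseArc a)) nil)

  tails-reverseArcs : ∀ as → tails (reverseArcs as) ↭ heads as
  tails-reverseArcs []       = ↭-refl
  tails-reverseArcs (a ∷ as) =
    ↭-trans (map⁺ tl (++-comm (reverseArcs as) _))
            (subst (λ z → z ∷ _ ↭ hd a ∷ heads as) (sym (tl-reverseArc a)) (prep _ (tails-reverseArcs as)))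

  edges-reverseArcs : ∀ as → edges (reverseArcs as) ↭ edges as
  edges-reverseArcs []       = ↭-refl
  edges-reverseArcs (a ∷ as) = ↭-trans (map⁺ ed (++-comm (reverseArcs as) _)) (prep _ (edges-reverseArcs as))

  All-reverseArcs : ∀ {P : Edge G → Set} as → All (P ∘ ed) as → All (P ∘ ed) (reverseArcs as)
  All-reverseArcs []       []         = []
  All-reverseArcs (a ∷ as) (pa ∷ pas) = Allₚ.∷ʳ⁺ (All-reverseArcs as pas) pa

  sameEdge : ∀ p q → ed p ≡ ed q → q ≡ p ⊎ q ≡ reverseArc p
  sameEdge (e , true)  (.e , true)  refl = inj₁ refl
  sameEdge (e , false) (.e , false) refl = inj₁ refl
  sameEdge (e , true)  (.e , false) refl = inj₂ refl
  sameEdge (e , false) (.e , true)  refl = inj₂ refl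

  sameEdge-endpoints : ∀ {P : Vertex G → Set} {c q} → ed c ≡ ed q → P (tl c) → P (hd c) → P (tl q) × P (hd q)
  sameEdge-endpoints {P = P} {c} {q} eq ptl phd with sameEdge c q eq
  ... | inj₁ refl = ptl , phd
  ... | inj₂ refl = subst P (sym (tl-reverseArc c)) phd , subst P (sym (hd-reverseArc c)) ptl

  ∈-tails⁻ : ∀ {z} xs → z ∈ tails xs → ∃₂ λ α c → ∃ λ β → xs ≡ α ++ c ∷ β × tl c ≡ z
  ∈-tails⁻ xs z∈ with c , c∈ , refl ← ∈-map⁻ tl z∈ with α , β , refl ← ∈-∃++ c∈ =
    α , c , β , refl , refl

  ∈-init⇒endpoints : ∀ {c} xs {z} → Walk G u (xs ∷ʳ z) v → c ∈ xs →
    tl c ∈ tails (xs ∷ʳ z) × hd c ∈ tails (xs ∷ʳ z)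
  ∈-init⇒endpoints xs {z} w c∈ with _ , wxs , wz ← walk-++⁻ xs w =
    ∈-map⁺ tl (∈-++⁺ˡ c∈) ,
    subst (_ ∈_) (sym (map-++ tl xs (z ∷ [])))
          (subst (λ t → _ ∈ tails xs ∷ʳ t) (sym (walk-start wz)) (heads⊆tails-∷ʳ wxs (∈-map⁺ hd c∈)))

  IsSimpleClosed : List (Arc G) → Set
  IsSimpleClosed w = (∃ λ v → Walk G v w v) × Unique (tails w) × Unique (edges w)

  rotate : ∀ xs {ys} → IsSimpleClosed (xs ++ ys) → IsSimpleClosed (ys ++ xs)
  rotate xs {ys} ((v , w) , ut , ue) with m , w₁ , w₂ ← walk-++⁻ xs w =
    (m , w₂ ++ʷ w₁) , Unique-resp-↭ (map⁺ tl (++-comm xs ys)) ut , Unique-resp-↭ (map⁺ ed (++-comm xs ys)) ue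

  cycle⇒simpleClosed : ∀ {w} → IsCycleWalk G w → IsSimpleClosed w
  cycle⇒simpleClosed {_ ∷ _} c = c

  glue : ∀ {P Q} → Walk G u P v → Walk G v Q u →
    Unique (tails P) → Unique (tails Q) → Disjoint (tails P) (tails Q) →
    Unique (edges P) → Unique (edges Q) → Disjoint (edges P) (edges Q) → IsSimpleClosed (P ++ Q)
  glue {P = P} {Q} wP wQ utP utQ tP#tQ ueP ueQ eP#eQ =
    (_ , wP ++ʷ wQ) ,
    subst Unique (sym (map-++ tl P Q)) (Uniqueₚ.++⁺ utP utQ tP#tQ) ,
    subst Unique (sym (map-++ ed P Q)) (Uniqueₚ.++⁺ ueP ueQ eP#eQ)

  around : ∀ xs {a ys} → Walk G v (xs ++ a ∷ ys) v → Walk G (hd a) (ys ++ xs) (tl a)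
  around xs w with _ , wxs , cons _ refl wys ← walk-++⁻ xs w = wys ++ʷ wxs

  splitAtRepeatedVertex : ∀ α {a β b γ} → Walk G v (α ++ a ∷ β ++ b ∷ γ) v → tl a ≡ tl b →
    Walk G (tl a) (a ∷ β) (tl a) × Walk G v (α ++ b ∷ γ) v
  splitAtRepeatedVertex α {a} {β} {b} {γ} w tla≡tlb
    with m , wα , wr ← walk-++⁻ α w
    with m′ , wβ , wγ ← walk-++⁻ (a ∷ β) wr
    with refl ← walk-start wr | refl ← walk-start wγ =
    subst (Walk G (tl a) (a ∷ β)) (sym tla≡tlb) wβ ,
    wα ++ʷ subst (λ z → Walk G z (b ∷ γ) _) (sym tla≡tlb) wγ

  removeBacktrack : ∀ α {p γ} → Walk G u (α ++ p ∷ reverseArc p ∷ γ) v → Walk G u (α ++ γ) v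
  removeBacktrack α {p} w with m , wα , cons _ refl (cons _ _ wγ) ← walk-++⁻ α w =
    wα ++ʷ subst (λ z → Walk G z _ _) (hd-reverseArc p) wγ

  backtrack : ∀ α {p β q γ} → Walk G u (α ++ p ∷ β ++ q ∷ γ) v →
    Unique (tails (α ++ p ∷ β ++ q ∷ γ)) → ed p ≡ ed q → β ≡ [] × q ≡ reverseArc p
  backtrack α {p} {β} {q} {γ} w ut edp≡edq with sameEdge p q edp≡edq
  ... | inj₁ refl = ⊥-elim (Collision⇒¬Unique tl (collision α p β p γ refl) ut)
  backtrack α {β = []} w ut _ | inj₂ refl = refl , refl
  backtrack α {p} {b ∷ β} {γ = γ} w ut _ | inj₂ refl with _ , _ , cons _ _ wr ← walk-++⁻ α w =
    ⊥-elim (Collision⇒¬Unique tl repeat ut)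
    where
    repeat : Collision tl (α ++ p ∷ b ∷ β ++ reverseArc p ∷ γ)
    repeat = subst (Collision tl) (++-assoc α [ p ] _)
                   (collision (α ∷ʳ p) b β (reverseArc p) γ (trans (walk-start wr) (sym (tl-reverseArc p))))

  private
    suffixFrom : ∀ {bs} → Walk G m bs v → Unique (tails bs ∷ʳ v) → u ∈ tails bs ∷ʳ v →
      ∃ λ γ → Walk G u γ v × Unique (tails γ ∷ʳ v) × γ ⊆ bs
    suffixFrom nil             un       (here refl) = [] , nil , un , λ ()
    suffixFrom (cons c refl w) un       (here refl) = _ , cons c refl w , un , λ c∈ → c∈
    suffixFrom (cons c refl w) (_ ∷ un) (there z∈)  with γ , wγ , uγ , γ⊆ ← suffixFrom w un z∈ =
      γ , wγ , uγ , there ∘ γ⊆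

  loopErase : Walk G u as v → ∃ λ π → Walk G u π v × Unique (tails π ∷ʳ v) × π ⊆ as
  loopErase nil = [] , nil , [] ∷ [] , λ ()
  loopErase {v = v} (cons a refl w) with π , wπ , uπ , π⊆ ← loopErase w with any? (tl a ≟_) (tails π ∷ʳ v)
  ... | yes z∈ with γ , wγ , uγ , γ⊆ ← suffixFrom wπ uπ z∈ = γ , wγ , uγ , there ∘ π⊆ ∘ γ⊆
  ... | no z∉ = a ∷ π , cons a refl wπ , Allₚ.¬Any⇒All¬ _ z∉ ∷ uπ , λ where
    (here refl) → here refl
    (there c∈)  → there (π⊆ c∈)

  path-edges : ∀ {π} → Walk G u π v → Unique (tails π ∷ʳ v) → Unique (edges π)
  path-edges nil                       _            = []
  path-edges {v = v} (cons q {π} refl w) (tlq∉ ∷ un) = Allₚ.map⁺ (All.tabulate edq≢) ∷ path-edges w un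
    where
    edq≢ : ∀ {c} → c ∈ π → ed q ≢ ed c
    edq≢ {c} c∈ eq with sameEdge q c eq
    ... | inj₁ refl = All.lookup tlq∉ (∈-++⁺ˡ (∈-map⁺ tl c∈)) refl
    ... | inj₂ refl =
      All.lookup tlq∉ (subst (_∈ tails π ∷ʳ v) (hd-reverseArc q) (heads⊆tails-∷ʳ w (∈-map⁺ hd c∈))) refl

  module Crossing {Bad Good : Vertex G → Set} (bad? : Decidable Bad) (good? : Decidable Good) where

    Off : Vertex G → Set
    Off z = ¬ Bad z × ¬ Good z

    -- On a path from s to x, saying that every arc is InnerArc s x says that the inner vertices
    -- are Off; stated arc by arc, it passes to sub-lists.
    InnerArc : Vertex G → Vertex G → Arc G → Set
    InnerArc s x q = (tl q ≡ s ⊎ Off (tl q)) × (hd q ≡ x ⊎ Off (hd q))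

    record Bridge (R : List (Arc G)) : Set where
      field
        {from to} : Vertex G
        arcs      : List (Arc G)
        walk      : Walk G from arcs to
        path      : Unique (tails arcs ∷ʳ to)
        from-bad  : Bad from
        to-good   : Good to
        arcs⊆R    : arcs ⊆ R
        inner     : All (InnerArc from to) arcs

    private
      Segment : Vertex G → List (Arc G) → Set
      Segment s R = ∃₂ λ x Q → Walk G s Q x × Good x × Q ⊆ R × All (InnerArc s x) Q

      segment : ∀ {s t R} → Walk G s R t → Good t → ¬ Good s → Segment s R ⊎ ∃ λ y → Bad y × Segment y R
      segment nil gt ¬gs = ⊥-elim (¬gs gt)
      segment (cons a refl w) gt ¬gs with good? (hd a)
      ... | yes g =
        inj₁ (hd a , a ∷ [] , cons a refl nil , g , (λ { (here refl) → here refl }) , (inj₁ refl , inj₁ refl) ∷ [])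
      ... | no ¬g with segment w gt ¬g
      ...   | inj₂ (y , by , x , Q , wQ , gx , Q⊆ , inn) = inj₂ (y , by , x , Q , wQ , gx , there ∘ Q⊆ , inn)
      ...   | inj₁ (x , Q , wQ , gx , Q⊆ , inn) with bad? (hd a)
      ...     | yes b  = inj₂ (hd a , b , x , Q , wQ , gx , there ∘ Q⊆ , inn)
      ...     | no ¬b = inj₁ (x , a ∷ Q , cons a refl wQ , gx , ⊆-cons Q⊆ ,
                              (inj₁ refl , inj₂ (¬b , ¬g)) ∷ All.map (λ {q} → off-start {q}) inn)
        where
        ⊆-cons : Q ⊆ _ → a ∷ Q ⊆ a ∷ _
        ⊆-cons Q⊆ (here refl) = here refl
        ⊆-cons Q⊆ (there c∈)  = there (Q⊆ c∈)
        off-start : ∀ {q} → InnerArc (hd a) x q → InnerArc (tl a) x q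
        off-start (inj₁ eq , h) = inj₂ (subst Off (sym eq) (¬b , ¬g)) , h
        off-start (inj₂ o  , h) = inj₂ o , h

      toBridge : ∀ {s R} → Bad s → Segment s R → Bridge R
      toBridge bs (x , Q , wQ , gx , Q⊆ , inn) with π , wπ , uπ , π⊆ ← loopErase wQ =
        record { walk = wπ ; path = uπ ; from-bad = bs ; to-good = gx ; arcs⊆R = Q⊆ ∘ π⊆
               ; inner = Allₚ.anti-mono π⊆ inn }

    bridge : ∀ {s t R} → Walk G s R t → Bad s → Good t → ¬ Good s → Bridge R
    bridge w bs gt ¬gs with segment w gt ¬gs
    ... | inj₁ seg            = toBridge bs seg
    ... | inj₂ (y , by , seg) = toBridge by seg

  -- Vectors of arc sequences

  vec : List (Arc G) → EVec G
  vec = vecOf G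

  vec-∷ : ∀ a as e → vec (a ∷ as) e ≡ vec [ a ] e + vec as e
  vec-∷ (f , d) as e with f ≟ e
  ... | yes _ = cong (_+ vec as e) (sym (ℤₚ.+-identityʳ (sign G d)))
  ... | no  _ = sym (ℤₚ.+-identityˡ _)

  vec-++ : ∀ xs ys e → vec (xs ++ ys) e ≡ vec xs e + vec ys e
  vec-++ []       ys e = sym (ℤₚ.+-identityˡ _)
  vec-++ (x ∷ xs) ys e = begin
    vec (x ∷ xs ++ ys) e                ≡⟨ vec-∷ x (xs ++ ys) e ⟩
    vec [ x ] e + vec (xs ++ ys) e      ≡⟨ cong (vec [ x ] e +_) (vec-++ xs ys e) ⟩
    vec [ x ] e + (vec xs e + vec ys e) ≡⟨ ℤₚ.+-assoc (vec [ x ] e) _ _ ⟨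
    (vec [ x ] e + vec xs e) + vec ys e ≡⟨ cong (_+ vec ys e) (vec-∷ x xs e) ⟨
    vec (x ∷ xs) e + vec ys e           ∎
    where open ≡-Reasoning

  vec-rotate : ∀ xs ys e → vec (xs ++ ys) e ≡ vec (ys ++ xs) e
  vec-rotate xs ys e = trans (vec-++ xs ys e) (trans (ℤₚ.+-comm (vec xs e) _) (sym (vec-++ ys xs e)))

  vec-reverseArc : ∀ a e → vec [ reverseArc a ] e ≡ - vec [ a ] e
  vec-reverseArc (f , d) e with f ≟ e
  vec-reverseArc (f , true)  e | yes _ = refl
  vec-reverseArc (f , false) e | yes _ = refl
  ... | no _ = refl

  vec-reverseArcs : ∀ as e → vec (reverseArcs as) e ≡ - vec as e
  vec-reverseArcs []       e = refl
  vec-reverseArcs (a ∷ as) e = begin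
    vec (reverseArcs as ++ [ reverseArc a ]) e      ≡⟨ vec-++ (reverseArcs as) _ e ⟩
    vec (reverseArcs as) e + vec [ reverseArc a ] e ≡⟨ cong₂ _+_ (vec-reverseArcs as e) (vec-reverseArc a e) ⟩
    - vec as e + - vec [ a ] e                      ≡⟨ ℤₚ.neg-distrib-+ (vec as e) (vec [ a ] e) ⟨
    - (vec as e + vec [ a ] e)                      ≡⟨ cong -_ (ℤₚ.+-comm (vec as e) _) ⟩
    - (vec [ a ] e + vec as e)                      ≡⟨ cong -_ (vec-∷ a as e) ⟨
    - vec (a ∷ as) e                                ∎
    where open ≡-Reasoning

  vec-around : ∀ xs a ys e → vec (xs ++ a ∷ ys) e ≡ vec [ a ] e + vec (ys ++ xs) e
  vec-around xs a ys e = trans (vec-rotate xs (a ∷ ys) e) (vec-∷ a (ys ++ xs) e)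

  vec-split : ∀ α {a β b γ} e → vec (α ++ a ∷ β ++ b ∷ γ) e ≡ vec (a ∷ β) e + vec (α ++ b ∷ γ) e
  vec-split α {a} {β} {b} {γ} e = begin
    vec (α ++ (a ∷ β) ++ b ∷ γ) e                 ≡⟨ vec-++ α _ e ⟩
    vec α e + vec ((a ∷ β) ++ b ∷ γ) e            ≡⟨ cong (vec α e +_) (vec-++ (a ∷ β) _ e) ⟩
    vec α e + (vec (a ∷ β) e + vec (b ∷ γ) e)     ≡⟨ swap-middle (vec α e) (vec (a ∷ β) e) _ ⟩
    vec (a ∷ β) e + (vec α e + vec (b ∷ γ) e)     ≡⟨ cong (vec (a ∷ β) e +_) (vec-++ α _ e) ⟨
    vec (a ∷ β) e + vec (α ++ b ∷ γ) e            ∎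
    where
    open ≡-Reasoning
    swap-middle : ∀ x y z → x + (y + z) ≡ y + (x + z)
    swap-middle = solve-∀

  vec-backtrack : ∀ α p γ e → vec (α ++ p ∷ reverseArc p ∷ γ) e ≡ vec (α ++ γ) e
  vec-backtrack α p γ e = begin
    vec (α ++ p ∷ reverseArc p ∷ γ) e                     ≡⟨ vec-++ α _ e ⟩
    vec α e + vec (p ∷ reverseArc p ∷ γ) e                ≡⟨ cong (vec α e +_) (vec-∷ p _ e) ⟩
    vec α e + (vec [ p ] e + vec (reverseArc p ∷ γ) e)    ≡⟨ cong (λ z → vec α e + (vec [ p ] e + z)) p⁻¹∷γ ⟩
    vec α e + (vec [ p ] e + (- vec [ p ] e + vec γ e))   ≡⟨ cancel (vec α e) (vec [ p ] e) (vec γ e) ⟩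
    vec α e + vec γ e                                     ≡⟨ vec-++ α γ e ⟨
    vec (α ++ γ) e                                        ∎
    where
    open ≡-Reasoning
    cancel : ∀ x y z → x + (y + (- y + z)) ≡ x + z
    cancel = solve-∀
    p⁻¹∷γ : vec (reverseArc p ∷ γ) e ≡ - vec [ p ] e + vec γ e
    p⁻¹∷γ = trans (vec-∷ (reverseArc p) γ e) (cong (_+ vec γ e) (vec-reverseArc p e))

  -- Closed walks in a forest

  module _ (B : Edge G → Bool) where

    -- NonTree is the predicate filtered by nonTreeArcs, so the library's filter lemmas apply.
    InB NonTree : Arc G → Set
    InB a     = B (ed a) ≡ true
    NonTree a = T (not (B (ed a)))

    nonTree? : Decidable NonTree
    nonTree? = T? ∘ (not ∘ B ∘ ed)

    nonTree : List (Arc G) → List (Arc G)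
    nonTree = nonTreeArcs G B

    Acyclic : Set
    Acyclic = ∀ w → IsCycleWalk G w → ¬ All InB w

    InB⇒¬NonTree : ∀ {a} → InB a → ¬ NonTree a
    InB⇒¬NonTree inB = subst (T ∘ not) inB

    ¬NonTree⇒InB : ∀ {a} → ¬ NonTree a → InB a
    ¬NonTree⇒InB {a} ¬t with B (ed a)
    ... | true  = refl
    ... | false = ⊥-elim (¬t tt)

    nonTree-++ : ∀ xs ys → nonTree (xs ++ ys) ≡ nonTree xs ++ nonTree ys
    nonTree-++ = filter-++ nonTree?

    All-InB⇒nonTree≡[] : All InB xs → nonTree xs ≡ []
    All-InB⇒nonTree≡[] = filter-none nonTree? ∘ All.map (λ {a} → InB⇒¬NonTree {a})

    All∁NonTree⇒All-InB : All (∁ NonTree) xs → All InB xs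
    All∁NonTree⇒All-InB = All.map (λ {a} → ¬NonTree⇒InB {a})

    nonTree≡[]⇒All-InB : ∀ xs → nonTree xs ≡ [] → All InB xs
    nonTree≡[]⇒All-InB xs = All∁NonTree⇒All-InB ∘ filter≡[]⇒All∁ nonTree? xs

    nonTree-++-tree : ∀ xs {ys} → All InB ys → nonTree (xs ++ ys) ≡ nonTree xs
    nonTree-++-tree xs {ys} inB =
      trans (nonTree-++ xs ys) (trans (cong (nonTree xs ++_) (All-InB⇒nonTree≡[] inB)) (++-identityʳ _))

    nonTree-rotate-tree : ∀ xs ys → All InB xs → nonTree (ys ++ xs) ≡ nonTree (xs ++ ys)
    nonTree-rotate-tree xs ys inB =
      trans (nonTree-++-tree ys inB)
            (sym (trans (nonTree-++ xs ys) (cong (_++ nonTree ys) (All-InB⇒nonTree≡[] inB))))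

    module _ (acyclic : Acyclic) where

      private
        closedWalk-vec≡0′ : ∀ {v w} → Acc Shorter w → Walk G v w v → All InB w → ∀ e → vec w e ≡ 0ℤ
        closedWalk-vec≡0′ {v} {w} (acc shorter) wk inB e with unique⊎collision tl _≟_ w
        ... | inj₂ (collision α a β b γ tla≡tlb) with loop , rest ← splitAtRepeatedVertex α wk tla≡tlb =
          begin
            vec (α ++ a ∷ β ++ b ∷ γ) e         ≡⟨ vec-split α e ⟩
            vec (a ∷ β) e + vec (α ++ b ∷ γ) e  ≡⟨ cong₂ _+_ loop≡0 rest≡0 ⟩
            0ℤ                                  ∎
          where
          open ≡-Reasoning
          loop≡0 : vec (a ∷ β) e ≡ 0ℤ
          loop≡0 = closedWalk-vec≡0′ (shorter (length-∷-< α)) loop (All-middle α (a ∷ β) inB) e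
          rest≡0 : vec (α ++ b ∷ γ) e ≡ 0ℤ
          rest≡0 = closedWalk-vec≡0′ (shorter (length-++-< α)) rest (All-deleteMiddle α (a ∷ β) inB) e
        ... | inj₁ ut with unique⊎collision ed _≟_ w
        ...   | inj₂ (collision α p β q γ edp≡edq) with refl , refl ← backtrack α wk ut edp≡edq =
          trans (vec-backtrack α p γ e)
                (closedWalk-vec≡0′ (shorter (length-++-< α)) (removeBacktrack α wk)
                                   (All-deleteMiddle α (p ∷ reverseArc p ∷ []) inB) e)
        closedWalk-vec≡0′ {w = []}        _ _  _   _ | inj₁ ut | inj₁ ue = refl
        closedWalk-vec≡0′ {v} {w = _ ∷ _} _ wk inB _ | inj₁ ut | inj₁ ue =
          ⊥-elim (acyclic _ ((v , wk) , ut , ue) inB)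

      closedWalk-vec≡0 : ∀ {v w} → Walk G v w v → All InB w → ∀ e → vec w e ≡ 0ℤ
      closedWalk-vec≡0 = closedWalk-vec≡0′ (shorter-wellFounded _)

      treeWalks-vec≡ : ∀ {u v p q} → Walk G u p v → Walk G u q v → All InB p → All InB q →
        ∀ e → vec p e ≡ vec q e
      treeWalks-vec≡ {p = p} {q} wp wq inBp inBq e = ℤₚ.i-j≡0⇒i≡j _ _ (begin
        vec p e + - vec q e               ≡⟨ cong (vec p e +_) (vec-reverseArcs q e) ⟨
        vec p e + vec (reverseArcs q) e   ≡⟨ vec-++ p _ e ⟨
        vec (p ++ reverseArcs q) e        ≡⟨ closedWalk-vec≡0 (wp ++ʷ walk-reverse wq)
                                                               (Allₚ.++⁺ inBp (All-reverseArcs q inBq)) e ⟩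
        0ℤ                                ∎)
        where open ≡-Reasoning

      closedWalksThrough-vec≡ : ∀ {v v′ a} xs ys xs′ ys′ →
        Walk G v (xs ++ a ∷ ys) v → Walk G v′ (xs′ ++ a ∷ ys′) v′ →
        All InB (xs ++ ys) → All InB (xs′ ++ ys′) → ∀ e → vec (xs ++ a ∷ ys) e ≡ vec (xs′ ++ a ∷ ys′) e
      closedWalksThrough-vec≡ {a = a} xs ys xs′ ys′ w w′ inB inB′ e = begin
        vec (xs ++ a ∷ ys) e            ≡⟨ vec-around xs a ys e ⟩
        vec [ a ] e + vec (ys ++ xs) e  ≡⟨ cong (vec [ a ] e +_) (treeWalks-vec≡ (around xs w) (around xs′ w′)
                                                                                 (swap xs inB) (swap xs′ inB′) e) ⟩
        vec [ a ] e + vec (ys′ ++ xs′) e ≡⟨ vec-around xs′ a ys′ e ⟨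
        vec (xs′ ++ a ∷ ys′) e          ∎
        where
        open ≡-Reasoning
        swap : ∀ as {bs} → All InB (as ++ bs) → All InB (bs ++ as)
        swap as inB with inBas , inBbs ← Allₚ.++⁻ as inB = Allₚ.++⁺ inBbs inBas

      fundamentalCycle-vec : ∀ {w a c} → IsCycleWalk G w → nonTree w ≡ a ∷ [] → IsFundamentalCycle G B a c →
        ∀ e → c e ≡ vec w e
      fundamentalCycle-vec {w} {a} cw nT≡ (f , cf , inB⊎a , a∈f , c≗) e
        with (_ , wk) , _ ← cycle⇒simpleClosed cw
           | (_ , wf) , _ , uef ← cycle⇒simpleClosed cf
        with pre , post , refl , ∁pre , _ , nTpost ← filter≡∷⁻ nonTree? w nT≡
           | f₁ , f₂ , refl ← ∈-∃++ a∈f =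
        trans (c≗ e) (closedWalksThrough-vec≡ f₁ f₂ pre post wf wk inBf inBw e)
        where
        inBw : All InB (pre ++ post)
        inBw = Allₚ.++⁺ (All∁NonTree⇒All-InB ∁pre) (nonTree≡[]⇒All-InB post nTpost)
        inBf : All InB (f₁ ++ f₂)
        inBf = All.zipWith (λ { (inj₁ inB , _) → inB ; (inj₂ eq , ne) → ⊥-elim (ne eq) })
                 (All-deleteMiddle f₁ (a ∷ []) inB⊎a , Unique-map-middle ed f₁ uef)

    -- Splitting a cycle along a tree path

    record CycleSplit (w : List (Arc G)) : Set where
      field
        {D₁ D₂}  : List (Arc G)
        cycle₁   : IsCycleWalk G D₁
        cycle₂   : IsCycleWalk G D₂
        nonTree≡ : nonTree D₁ ++ nonTree D₂ ≡ nonTree w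
        vec≡     : ∀ e → vec w e ≡ vec D₁ e + vec D₂ e

    module BridgeSplit (spans : ∀ u v → ∃ λ R → Walk G u R v × All InB R)
      {v₀ τ a M′ b} (wC : Walk G v₀ ((τ ∷ʳ a) ++ (M′ ∷ʳ b)) v₀)
      (utC : Unique (tails ((τ ∷ʳ a) ++ (M′ ∷ʳ b)))) (ueC : Unique (edges ((τ ∷ʳ a) ++ (M′ ∷ʳ b))))
      (inBτ : All InB τ) (nta : NonTree a) (ntb : NonTree b) where

      L M C : List (Arc G)
      L = τ ∷ʳ a
      M = M′ ∷ʳ b
      C = L ++ M

      Bad Good : Vertex G → Set
      Bad z  = z ∈ tails L
      Good z = z ∈ tails M

      open Crossing {Bad} {Good} (λ z → any? (z ≟_) (tails L)) (λ z → any? (z ≟_) (tails M))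

      bad#good : Disjoint (tails L) (tails M)
      bad#good = proj₂ (proj₂ (Unique-++⁻ (tails L) (subst Unique (map-++ tl L M) utC)))

      bad⇒onC : ∀ {z} → Bad z → z ∈ tails C
      bad⇒onC z∈ = subst (_ ∈_) (sym (map-++ tl L M)) (∈-++⁺ˡ z∈)

      good⇒onC : ∀ {z} → Good z → z ∈ tails C
      good⇒onC z∈ = subst (_ ∈_) (sym (map-++ tl L M)) (∈-++⁺ʳ (tails L) z∈)

      onC⇒¬Off : ∀ {z} → z ∈ tails C → ¬ Off z
      onC⇒¬Off z∈ (¬bad , ¬good) with ∈-++⁻ (tails L) (subst (_ ∈_) (map-++ tl L M) z∈)
      ... | inj₁ bad  = ¬bad bad
      ... | inj₂ good = ¬good good

      treeArc-sameSide : ∀ {c} → c ∈ C → InB c → (Bad (tl c) × Bad (hd c)) ⊎ (Good (tl c) × Good (hd c))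
      treeArc-sameSide c∈ inB with _ , wL , wM ← walk-++⁻ L wC with ∈-++⁻ L c∈
      ... | inj₁ c∈L with ∈-++⁻ τ c∈L
      ...   | inj₁ c∈τ         = inj₁ (∈-init⇒endpoints τ wL c∈τ)
      ...   | inj₂ (here refl) = ⊥-elim (InB⇒¬NonTree {a} inB nta)
      treeArc-sameSide c∈ inB | inj₂ c∈M with ∈-++⁻ M′ c∈M
      ...   | inj₁ c∈M′        = inj₂ (∈-init⇒endpoints M′ wM c∈M′)
      ...   | inj₂ (here refl) = ⊥-elim (InB⇒¬NonTree {b} inB ntb)

      tl-a-bad : Bad (tl a)
      tl-a-bad = ∈-map⁺ tl (∈-++⁺ʳ τ (here refl))

      tl-b-good : Good (tl b)
      tl-b-good = ∈-map⁺ tl (∈-++⁺ʳ M′ (here refl))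

      treePath : ∃ λ R → Walk G (tl a) R (tl b) × All InB R
      treePath = spans (tl a) (tl b)

      theBridge : Bridge (proj₁ treePath)
      theBridge = bridge (proj₁ (proj₂ treePath)) tl-a-bad tl-b-good (λ good → bad#good (tl-a-bad , good))

      open Bridge theBridge renaming (from to y; to to x; arcs to Q; walk to wQ; path to pathQ)

      inBQ : All InB Q
      inBQ = Allₚ.anti-mono arcs⊆R (proj₂ (proj₂ treePath))

      tl-onC : ∀ {q} → q ∈ Q → tl q ∈ tails C → tl q ≡ y
      tl-onC q∈ onC with proj₁ (All.lookup inner q∈)
      ... | inj₁ eq  = eq
      ... | inj₂ off = ⊥-elim (onC⇒¬Off onC off)

      hd-onC : ∀ {q} → q ∈ Q → hd q ∈ tails C → hd q ≡ x
      hd-onC q∈ onC with proj₂ (All.lookup inner q∈)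
      ... | inj₁ eq  = eq
      ... | inj₂ off = ⊥-elim (onC⇒¬Off onC off)

      -- Both ends of c lie on one side, so q would join y to x, which lie on different sides.
      Q-edge∉C : ∀ {q c} → q ∈ Q → c ∈ C → ed q ≢ ed c
      Q-edge∉C {q} {c} q∈ c∈ eq with treeArc-sameSide c∈ (subst (λ e → B e ≡ true) eq (All.lookup inBQ q∈))
      ... | inj₁ (bt , bh) with _ , bq ← sameEdge-endpoints {P = Bad} {c} {q} (sym eq) bt bh =
        bad#good (subst Bad (hd-onC q∈ (bad⇒onC bq)) bq , to-good)
      ... | inj₂ (gt , gh) with gq , _ ← sameEdge-endpoints {P = Good} {c} {q} (sym eq) gt gh =
        bad#good (from-bad , subst Good (tl-onC q∈ (good⇒onC gq)) gq)

      module Cut {s₁ c₁ s₂′ r₁ d₁ r₂′} (L≡ : L ≡ s₁ ++ c₁ ∷ s₂′) (tlc₁≡y : tl c₁ ≡ y)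
                                        (M≡ : M ≡ r₁ ++ d₁ ∷ r₂′) (tld₁≡x : tl d₁ ≡ x) where

        s₂ r₂ P₁ P₂ D₁ D₂ : List (Arc G)
        s₂ = c₁ ∷ s₂′
        r₂ = d₁ ∷ r₂′
        P₁ = s₂ ++ r₁
        P₂ = r₂ ++ s₁
        D₁ = P₁ ++ reverseArcs Q
        D₂ = P₂ ++ Q

        C≡ : C ≡ s₁ ++ (s₂ ++ (r₁ ++ r₂))
        C≡ = trans (cong₂ _++_ L≡ M≡) (++-assoc s₁ s₂ (r₁ ++ r₂))

        rotated≡ : (s₂ ++ (r₁ ++ r₂)) ++ s₁ ≡ P₁ ++ P₂
        rotated≡ = begin
          (s₂ ++ (r₁ ++ r₂)) ++ s₁  ≡⟨ ++-assoc s₂ (r₁ ++ r₂) s₁ ⟩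
          s₂ ++ ((r₁ ++ r₂) ++ s₁)  ≡⟨ cong (s₂ ++_) (++-assoc r₁ r₂ s₁) ⟩
          s₂ ++ (r₁ ++ (r₂ ++ s₁))  ≡⟨ ++-assoc s₂ r₁ (r₂ ++ s₁) ⟨
          P₁ ++ P₂                  ∎
          where open ≡-Reasoning

        P⊆C : P₁ ++ P₂ ⊆ C
        P⊆C {c} c∈ =
          subst (c ∈_) (sym C≡) (∈-resp-↭ (++-comm (s₂ ++ (r₁ ++ r₂)) s₁) (subst (c ∈_) (sym rotated≡) c∈))

        P₁⊆C : P₁ ⊆ C
        P₁⊆C = P⊆C ∘ ∈-++⁺ˡ

        P₂⊆C : P₂ ⊆ C
        P₂⊆C = P⊆C ∘ ∈-++⁺ʳ P₁

        simple : IsSimpleClosed (P₁ ++ P₂)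
        simple = subst IsSimpleClosed rotated≡ (rotate s₁ (subst IsSimpleClosed C≡ ((v₀ , wC) , utC , ueC)))

        walks : Walk G y P₁ x × Walk G x P₂ y
        walks with (_ , w) , _ ← simple with _ , w₁ , w₂ ← walk-++⁻ P₁ w
              with refl ← walk-start w₁ | refl ← walk-start w₂ =
          subst₂ (λ s t → Walk G s P₁ t) tlc₁≡y tld₁≡x w₁ , subst₂ (λ s t → Walk G s P₂ t) tld₁≡x tlc₁≡y w₂

        tails₁₂ : Unique (tails P₁) × Unique (tails P₂) × Disjoint (tails P₁) (tails P₂)
        tails₁₂ = Unique-++⁻ (tails P₁) (subst Unique (map-++ tl P₁ P₂) (proj₁ (proj₂ simple)))

        edges₁₂ : Unique (edges P₁) × Unique (edges P₂) × Disjoint (edges P₁) (edges P₂)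
        edges₁₂ = Unique-++⁻ (edges P₁) (subst Unique (map-++ ed P₁ P₂) (proj₂ (proj₂ simple)))

        unique-tails-Q : Unique (tails Q)
        unique-tails-Q = proj₁ (Unique-++⁻ (tails Q) pathQ)

        unique-heads-Q : Unique (heads Q)
        unique-heads-Q with _ ∷ u ← subst Unique (tails-∷ʳ wQ) pathQ = u

        unique-edges-Q : Unique (edges Q)
        unique-edges-Q = path-edges wQ pathQ

        tails-P₂#Q : Disjoint (tails P₂) (tails Q)
        tails-P₂#Q (z∈P₂ , z∈Q) with q , q∈ , refl ← ∈-map⁻ tl z∈Q =
          proj₂ (proj₂ tails₁₂)
            (subst (_∈ tails P₁) (sym (tl-onC q∈ (Subsetₚ.map⁺ tl P₂⊆C z∈P₂))) (here (sym tlc₁≡y)) , z∈P₂)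

        tails-P₁#Q⁻¹ : Disjoint (tails P₁) (tails (reverseArcs Q))
        tails-P₁#Q⁻¹ (z∈P₁ , z∈Q⁻¹) with q , q∈ , refl ← ∈-map⁻ hd (∈-resp-↭ (tails-reverseArcs Q) z∈Q⁻¹) =
          proj₂ (proj₂ tails₁₂)
            (z∈P₁ , subst (_∈ tails P₂) (sym (hd-onC q∈ (Subsetₚ.map⁺ tl P₁⊆C z∈P₁))) (here (sym tld₁≡x)))

        edges-C#Q : ∀ {P} → P ⊆ C → Disjoint (edges P) (edges Q)
        edges-C#Q P⊆ (f∈P , f∈Q) with c , c∈ , refl ← ∈-map⁻ ed f∈P with q , q∈ , eq ← ∈-map⁻ ed f∈Q =
          Q-edge∉C q∈ (P⊆ c∈) (sym eq)

        cycle₁ : IsCycleWalk G D₁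
        cycle₁ = glue (proj₁ walks) (walk-reverse wQ)
          (proj₁ tails₁₂) (Unique-resp-↭ (↭-sym (tails-reverseArcs Q)) unique-heads-Q) tails-P₁#Q⁻¹
          (proj₁ edges₁₂) (Unique-resp-↭ (↭-sym (edges-reverseArcs Q)) unique-edges-Q)
          (λ (f∈P₁ , f∈Q⁻¹) → edges-C#Q P₁⊆C (f∈P₁ , ∈-resp-↭ (edges-reverseArcs Q) f∈Q⁻¹))

        cycle₂ : IsCycleWalk G D₂
        cycle₂ = glue (proj₂ walks) wQ
          (proj₁ (proj₂ tails₁₂)) unique-tails-Q tails-P₂#Q
          (proj₁ (proj₂ edges₁₂)) unique-edges-Q (edges-C#Q P₂⊆C)

        nonTree≡ : nonTree D₁ ++ nonTree D₂ ≡ nonTree C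
        nonTree≡ = begin
          nonTree D₁ ++ nonTree D₂            ≡⟨ cong₂ _++_ (nonTree-++-tree P₁ (All-reverseArcs Q inBQ))
                                                                (nonTree-++-tree P₂ inBQ) ⟩
          nonTree P₁ ++ nonTree P₂            ≡⟨ nonTree-++ P₁ P₂ ⟨
          nonTree (P₁ ++ P₂)                  ≡⟨ cong nonTree rotated≡ ⟨
          nonTree ((s₂ ++ (r₁ ++ r₂)) ++ s₁)  ≡⟨ nonTree-rotate-tree s₁ _ inBs₁ ⟩
          nonTree (s₁ ++ (s₂ ++ (r₁ ++ r₂)))  ≡⟨ cong nonTree C≡ ⟨
          nonTree C                           ∎
          where
          open ≡-Reasoning
          inBs₁ : All InB s₁
          inBs₁ = Allₚ.++⁻ˡ s₁ (subst (All InB) (proj₂ (∷ʳ≡++∷⇒prefix τ s₁ L≡)) inBτ)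

        vec≡ : ∀ e → vec C e ≡ vec D₁ e + vec D₂ e
        vec≡ e = begin
          vec C e                                        ≡⟨ cong (λ w → vec w e) C≡ ⟩
          vec (s₁ ++ (s₂ ++ (r₁ ++ r₂))) e               ≡⟨ vec-rotate s₁ _ e ⟩
          vec ((s₂ ++ (r₁ ++ r₂)) ++ s₁) e               ≡⟨ cong (λ w → vec w e) rotated≡ ⟩
          vec (P₁ ++ P₂) e                               ≡⟨ vec-++ P₁ P₂ e ⟩
          vec P₁ e + vec P₂ e                            ≡⟨ insert (vec P₁ e) (vec P₂ e) (vec Q e) ⟩
          (vec P₁ e + - vec Q e) + (vec P₂ e + vec Q e)  ≡⟨ cong₂ _+_ (cong (vec P₁ e +_) (vec-reverseArcs Q e)) refl ⟨
          (vec P₁ e + vec (reverseArcs Q) e) + (vec P₂ e + vec Q e)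
                                                         ≡⟨ cong₂ _+_ (vec-++ P₁ _ e) (vec-++ P₂ Q e) ⟨
          vec D₁ e + vec D₂ e                            ∎
          where
          open ≡-Reasoning
          insert : ∀ p₁ p₂ q → p₁ + p₂ ≡ (p₁ + - q) + (p₂ + q)
          insert = solve-∀

        cycleSplit : CycleSplit C
        cycleSplit = record { cycle₁ = cycle₁ ; cycle₂ = cycle₂ ; nonTree≡ = nonTree≡ ; vec≡ = vec≡ }

      cycleSplit : CycleSplit C
      cycleSplit with s₁ , c₁ , s₂′ , L≡ , tlc₁≡y ← ∈-tails⁻ L from-bad
                 with r₁ , d₁ , r₂′ , M≡ , tld₁≡x ← ∈-tails⁻ M to-good =
        Cut.cycleSplit L≡ tlc₁≡y M≡ tld₁≡x

    CycleSplit-rotate : ∀ xs {ys} → All InB ys → CycleSplit (ys ++ xs) → CycleSplit (xs ++ ys)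
    CycleSplit-rotate xs {ys} inB s = record
      { cycle₁   = cycle₁
      ; cycle₂   = cycle₂
      ; nonTree≡ = trans nonTree≡ (sym (nonTree-rotate-tree ys xs inB))
      ; vec≡     = λ e → trans (vec-rotate xs ys e) (vec≡ e)
      }
      where open CycleSplit s

    split : (∀ u v → ∃ λ R → Walk G u R v × All InB R) →
      ∀ {w a₁ a₂ as} → IsCycleWalk G w → nonTree w ≡ a₁ ∷ a₂ ∷ as → CycleSplit w
    -- a₁ and b are the first and last non-tree arcs of w; moving suf to the front gives the
    -- form that BridgeSplit needs.
    split spans {w} {a₁} {a₂} {as} cw nT≡
      with simple ← cycle⇒simpleClosed cw
      with pre , post , refl , ∁pre , nta , nTpost ← filter≡∷⁻ nonTree? w nT≡
      with ys , b , eq ← ∷≡∷ʳ a₂ as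
      with mid , suf , refl , _ , ntb , ∁suf ← filter≡∷ʳ⁻ nonTree? post (trans nTpost eq) =
      subst CycleSplit (sym w≡) (CycleSplit-rotate X inBsuf (subst CycleSplit C≡ splitC))
      where
      X : List (Arc G)
      X = pre ++ a₁ ∷ mid ∷ʳ b

      inBsuf : All InB suf
      inBsuf = All∁NonTree⇒All-InB ∁suf

      w≡ : pre ++ a₁ ∷ mid ++ b ∷ suf ≡ X ++ suf
      w≡ = sym (trans (++-assoc pre (a₁ ∷ mid ∷ʳ b) suf)
                      (cong (λ z → pre ++ a₁ ∷ z) (++-assoc mid (b ∷ []) suf)))

      C≡ : ((suf ++ pre) ∷ʳ a₁) ++ (mid ∷ʳ b) ≡ suf ++ X
      C≡ = trans (++-assoc (suf ++ pre) (a₁ ∷ []) (mid ∷ʳ b)) (++-assoc suf pre (a₁ ∷ mid ∷ʳ b))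

      splitC : CycleSplit (((suf ++ pre) ∷ʳ a₁) ++ (mid ∷ʳ b))
      splitC with (_ , wC) , utC , ueC ←
                    subst IsSimpleClosed (sym C≡) (rotate X (subst IsSimpleClosed w≡ simple)) =
        BridgeSplit.cycleSplit spans wC utC ueC (Allₚ.++⁺ inBsuf (All∁NonTree⇒All-InB ∁pre)) nta ntb

    module _ (acyclic : Acyclic) (spans : ∀ u v → ∃ λ R → Walk G u R v × All InB R) where

      nonTree-nonempty : ∀ {w} → IsCycleWalk G w → nonTree w ≢ []
      nonTree-nonempty {w} cw eq = acyclic w cw (nonTree≡[]⇒All-InB w eq)

      parenthesize : ∀ {w as cs} → Acc Shorter cs → IsCycleWalk G w → nonTree w ≡ as →
        Pointwise (IsFundamentalCycle G B) as cs →
        Σ (Paren G cs) λ p → InnerOK G p × (∀ e → value G p e ≡ vec w e)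
      parenthesizeSplit : ∀ {w a₁ a₂ as cs} → Acc Shorter cs → IsCycleWalk G w → nonTree w ≡ a₁ ∷ a₂ ∷ as →
        Pointwise (IsFundamentalCycle G B) (a₁ ∷ a₂ ∷ as) cs →
        Σ (Paren G cs) λ p → InnerOK G p × (∀ e → value G p e ≡ vec w e)

      parenthesize _   cw nT≡ []              = ⊥-elim (nonTree-nonempty cw nT≡)
      parenthesize _   cw nT≡ (fund ∷ [])     = leaf _ , tt , λ e → fundamentalCycle-vec acyclic cw nT≡ fund e
      parenthesize rec cw nT≡ pw@(_ ∷ _ ∷ _) = parenthesizeSplit rec cw nT≡ pw

      parenthesizeSplit {w} {cs = cs} (acc shorter) cw nT≡ pw
        with record { cycle₁ = cycle₁ ; cycle₂ = cycle₂ ; nonTree≡ = nonTree≡ ; vec≡ = vec≡ } ← split spans cw nT≡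
        with cs₁ , cs₂ , refl , pw₁ , pw₂ ←
               Pointwise-++⁻ _ (subst (λ as → Pointwise _ as cs) (sym (trans nonTree≡ nT≡)) pw)
        with p₁ , ok₁ , value₁ ←
               parenthesize (shorter (++-shorterˡ cs₁ (Pointwise-≢[] pw₂ (nonTree-nonempty cycle₂)))) cycle₁ refl pw₁
           | p₂ , ok₂ , value₂ ←
               parenthesize (shorter (++-shorterʳ cs₂ (Pointwise-≢[] pw₁ (nonTree-nonempty cycle₁)))) cycle₂ refl pw₂ =
        node p₁ p₂ , ((w , cw , value≡) , ok₁ , ok₂) , value≡
        where
        value≡ : ∀ e → value G p₁ e + value G p₂ e ≡ vec w e
        value≡ e = trans (cong₂ _+_ (value₁ e) (value₂ e)) (sym (vec≡ e))

  InnerOK⇒GoodParen : ∀ {cs} (p : Paren G cs) → InnerOK G p → GoodParen G p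
  InnerOK⇒GoodParen (leaf _)   _        = tt
  InnerOK⇒GoodParen (node _ _) (_ , ok) = ok

-- Connectivity of G is already part of IsSpanningTree G B.
lemma3p12 : (G : Graph) → Connected G →
    (B : Edge G → Bool) → IsSpanningTree G B →
    (w : List (Arc G)) → IsCycleWalk G w →
    (cs : List (EVec G)) →
    Pointwise (IsFundamentalCycle G B) (nonTreeArcs G B w) cs →
    Σ (Paren G cs) (GoodParen G)
lemma3p12 G _ B (spans , acyclic) w cw cs pw
  with p , ok , _ ← parenthesize G B acyclic spans (shorter-wellFounded cs) cw refl pw =
  p , InnerOK⇒GoodParen G p ok
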